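{- Let $d\geq 3$, let $G$ be a $d$-regular graph and $v$ a vertex of $G$, layered from $v$. Suppose that $\mathrm{d}'(u)\geq 1$ for all $u\in V_1$. Let $a,b\in V_2$ be distinct non-adjacent vertices such that $\mathrm{In}(a)=\mathrm{In}(b)=\{x\}$ for some $x\in V_1$. Then there is a $\Delta$-switch at $v$ transforming $G$ into a graph $G'$ such that ${\rm N}_{G'}(v)={\rm N}_G(v)$, the set of vertices at distance $2$ from $v$ is unchanged, the edges of $G[V_2]$ are unchanged, $a$ is still adjacent to $x$, and $b$ is adjacent in $G'$ to some $y\in V_1$ with $y\neq x$ (so that $a,b$ is above $x,y$).
   Context: All graphs are simple. Layering from $v$: let $C$ be the component of $G$ containing $v$; for $i\ge0$, $V_i$ is the set of vertices of $C$ at distance exactly $i$ from $v$ (so $V_1={\rm N}(v)$); $E_i$ is the edge set of $G[V_i]$. For $u\in V_i$: $\mathrm{d}'(u)=|{\rm N}(u)\cap V_i|$, $\mathrm{In}(u)={\rm N}(u)\cap V_{i-1}$, $\mathrm{Out}(u)={\rm N}(u)\cap V_{i+1}$. Vertices $a,b\in V_{i+1}$ are above $x,y\in V_i$ if $a\in\mathrm{Out}(x)$ and $b\in\mathrm{Out}(y)$. A $\Delta^+$-switch at $v$: if $v,x,y,w,z$ are distinct vertices with $yx, xv, vw, wz\in E$ and $xw, yz\notin E$, delete $xy$, $wz$ and insert $xw$, $yz$. A $\Delta^-$-switch at $v$ is the reverse: if $v,x,y,w,z$ are distinct, $G$ contains the triangle $v,x,w$ and the edge $yz$, and $xy,wz\notin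 E$, delete $xw$, $yz$ and insert $xy$, $wz$. A $\Delta$-switch at $v$ is either of these. -}

module Defs where

open import Data.Nat using (ℕ; zero; suc)
open import Data.Fin using (Fin)
open import Data.Bool using (Bool; true; false; if_then_else_)
open import Data.List using (List; map; allFin)
open import Data.Nat.ListAction using (sum)
open import Data.Product using (_×_; ∃; ∃-syntax; _,_)
open import Data.Sum using (_⊎_)
open import Relation.Nullary using (¬_)
open import Relation.Binary.PropositionalEquality using (_≡_; _≢_)
open import Function.Bundles using (_⇔_)

record Graph (n : ℕ) : Set where
  field
    adj    : Fin n → Fin n → Bool
    sym    : ∀ u w → adj u w ≡ adj w u
    irrefl : ∀ u → adj u u ≡ false
open Graph public

_∼[_]_ : ∀ {n} → Fin n → Graph n → Fin n → Set
u ∼[ G ] w = adj G u w ≡ true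

deg : ∀ {n} → Graph n → Fin n → ℕ
deg {n} G u = sum (map (λ w → if adj G u w then 1 else 0) (allFin n))

Regular : ∀ {n} → ℕ → Graph n → Set
Regular d G = ∀ u → deg G u ≡ d

data Walk≤ {n} (G : Graph n) : ℕ → Fin n → Fin n → Set where
  here : ∀ {k u} → Walk≤ G k u u
  step : ∀ {k u w z} → u ∼[ G ] w → Walk≤ G k w z → Walk≤ G (suc k) u z

Dist : ∀ {n} → Graph n → Fin n → Fin n → ℕ → Set
Dist G v u zero    = v ≡ u
Dist G v u (suc i) = Walk≤ G (suc i) v u × ¬ Walk≤ G i v u

Layer : ∀ {n} → Graph n → Fin n → ℕ → Fin n → Set
Layer G v i u = Dist G v u i

SamePair : ∀ {n} → Fin n → Fin n → Fin n → Fin n → Set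
SamePair p q a b = (p ≡ a × q ≡ b) ⊎ (p ≡ b × q ≡ a)

Swap : ∀ {n} → Graph n → Graph n →
       (e₁ e₂ e₃ e₄ f₁ f₂ f₃ f₄ : Fin n) → Set
Swap G G' e₁ e₂ e₃ e₄ f₁ f₂ f₃ f₄ =
  ∀ p q → (p ∼[ G' ] q) ⇔
    ((p ∼[ G ] q × ¬ SamePair p q e₁ e₂ × ¬ SamePair p q e₃ e₄)
      ⊎ SamePair p q f₁ f₂ ⊎ SamePair p q f₃ f₄)

Distinct5 : ∀ {n} → (a b c d e : Fin n) → Set
Distinct5 a b c d e =
  a ≢ b × a ≢ c × a ≢ d × a ≢ e × b ≢ c × b ≢ d × b ≢ e ×
  c ≢ d × c ≢ e × d ≢ e

Δ⁺Switch : ∀ {n} → Graph n → Fin n → Graph n → Set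
Δ⁺Switch G v G' = ∃[ x ] ∃[ y ] ∃[ w ] ∃[ z ]
  (Distinct5 v x y w z × y ∼[ G ] x × x ∼[ G ] v × v ∼[ G ] w × w ∼[ G ] z
   × ¬ (x ∼[ G ] w) × ¬ (y ∼[ G ] z)
   × Swap G G' x y w z x w y z)

Δ⁻Switch : ∀ {n} → Graph n → Fin n → Graph n → Set
Δ⁻Switch G v G' = ∃[ x ] ∃[ y ] ∃[ w ] ∃[ z ]
  (Distinct5 v x y w z × v ∼[ G ] x × v ∼[ G ] w × x ∼[ G ] w × y ∼[ G ] z
   × ¬ (x ∼[ G ] y) × ¬ (w ∼[ G ] z)
   × Swap G G' x w y z x y w z)

ΔSwitch : ∀ {n} → Graph n → Fin n → Graph n → Set
ΔSwitch G v G' = Δ⁺Switch G v G' ⊎ Δ⁻Switch G v G'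

-- If every neighbour of v other than x were adjacent to x, then N(x) would
-- contain N(v) ∖ {x} together with v, a and b, so deg x ≥ deg v + 2, which is
-- impossible in a regular graph. Hence some w ∈ N(v), w ≠ x, is not adjacent
-- to x; by hypothesis w has a neighbour y ∈ V₁, and y ≠ x because x ≁ w.
-- The Δ⁺-switch at v on the path b x v w y replaces xb, wy by xw, by. Every
-- changed pair contains x, w or y, so N(v) and all adjacencies inside V₂ are
-- kept, and b stays at distance 2 through its new neighbour y.
module Submission where

open import Defs
open import Data.Nat using (ℕ; zero; suc; _≥_; _+_; _≤_; z≤n; s≤s)
open import Data.Nat.Properties
  using (+-mono-≤; +-assoc; +-cancelʳ-≤; m≤n+m; m+1+n≰m; +-commutativeSemigroup)
open import Algebra.Properties.CommutativeSemigroup +-commutativeSemigroup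
  using (interchange)
open import Data.Nat.ListAction using (sum)
open import Data.Bool using (Bool; true; false; if_then_else_)
import Data.Bool as Bool
open import Data.Fin using (Fin; _≟_)
import Data.Fin as Fin
open import Data.Fin.Properties using (all?; ¬∀⟶∃¬)
open import Data.List using (List; []; _∷_; map; allFin; tabulate)
open import Data.List.Properties using (map-tabulate)
open import Data.Product using (_×_; ∃-syntax; _,_; proj₂)
open import Data.Sum using (_⊎_; inj₁; inj₂)
open import Relation.Nullary using (¬_; Dec; yes; no; does; contradiction)
open import Relation.Nullary.Decidable
  using (_×-dec_; _⊎-dec_; _→-dec_; ¬?; dec-true; dec-false; does-⇔; decidable-stable)
open import Relation.Binary.PropositionalEquality
  using (_≡_; _≢_; refl; trans; cong; subst₂; ≢-sym; module ≡-Reasoning)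
import Relation.Binary.PropositionalEquality as ≡
open import Function.Bundles using (_⇔_; mk⇔; Equivalence)
open Equivalence using (to; from)

private
  variable
    n : ℕ
    A : Set

does-true⇒ : (a? : Dec A) → does a? ≡ true → A
does-true⇒ (yes a) _ = a
does-true⇒ (no _) ()

sum-map-+ : (f g : A → ℕ) (xs : List A) →
            sum (map (λ a → f a + g a) xs) ≡ sum (map f xs) + sum (map g xs)
sum-map-+ f g []       = refl
sum-map-+ f g (a ∷ xs) =
  trans (cong (f a + g a +_) (sum-map-+ f g xs)) (interchange (f a) (g a) _ _)

sum-map-mono-≤ : {f g : A → ℕ} → (∀ a → f a ≤ g a) →
                 (xs : List A) → sum (map f xs) ≤ sum (map g xs)
sum-map-mono-≤ f≤g []       = z≤n
sum-map-mono-≤ f≤g (a ∷ xs) = +-mono-≤ (f≤g a) (sum-map-mono-≤ f≤g xs)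

indicator : Fin n → Fin n → ℕ
indicator c w = if does (w ≟ c) then 1 else 0

indicator-≢ : {c w : Fin n} → w ≢ c → indicator c w ≡ 0
indicator-≢ {c = c} {w} w≢c with w ≟ c
... | yes w≡c = contradiction w≡c w≢c
... | no _    = refl

sum-tabulate-0 : ∀ n → sum (tabulate {n = n} (λ _ → 0)) ≡ 0
sum-tabulate-0 zero    = refl
sum-tabulate-0 (suc n) = sum-tabulate-0 n

sum-tabulate-indicator : (c : Fin n) → sum (tabulate (indicator c)) ≡ 1
sum-tabulate-indicator {suc n} Fin.zero    = cong suc (sum-tabulate-0 n)
sum-tabulate-indicator {suc n} (Fin.suc c) = sum-tabulate-indicator c

sum-indicator : (c : Fin n) → sum (map (indicator c) (allFin n)) ≡ 1
sum-indicator c = trans (cong sum (map-tabulate (λ w → w) (indicator c)))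
                        (sum-tabulate-indicator c)

module _ (G : Graph n) where

  ∼? : ∀ p q → Dec (p ∼[ G ] q)
  ∼? p q = adj G p q Bool.≟ true

  ∼-sym : ∀ {p q} → p ∼[ G ] q → q ∼[ G ] p
  ∼-sym {p} {q} p∼q = trans (sym G q p) p∼q

  ∼⇒≢ : ∀ {p q} → p ∼[ G ] q → p ≢ q
  ∼⇒≢ {p} p∼p refl = contradiction (trans (≡.sym p∼p) (irrefl G p)) λ ()

  layer₁⇒∼ : ∀ {v u} → Layer G v 1 u → v ∼[ G ] u
  layer₁⇒∼ (here          , ¬here) = contradiction here ¬here
  layer₁⇒∼ (step v∼u here , _)     = v∼u

  ∼⇒layer₁ : ∀ {v u} → v ∼[ G ] u → Layer G v 1 u
  ∼⇒layer₁ v∼u = step v∼u here , λ { here → ∼⇒≢ v∼u refl }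

  layer₂⇒≢ : ∀ {v u} → Layer G v 2 u → v ≢ u
  layer₂⇒≢ (_ , ¬walk) refl = ¬walk here

  layer₂⇒≁ : ∀ {v u} → Layer G v 2 u → ¬ v ∼[ G ] u
  layer₂⇒≁ (_ , ¬walk) v∼u = ¬walk (step v∼u here)

  layer₂⇒≢-neighbour : ∀ {v u c} → Layer G v 2 u → v ∼[ G ] c → u ≢ c
  layer₂⇒≢-neighbour Lu v∼u refl = layer₂⇒≁ Lu v∼u

  layer₂⇒path : ∀ {v u} → Layer G v 2 u → ∃[ m ] (v ∼[ G ] m × m ∼[ G ] u)
  layer₂⇒path (here , ¬walk)                 = contradiction here ¬walk
  layer₂⇒path (step v∼u here , ¬walk)        = contradiction (step v∼u here) ¬walk
  layer₂⇒path (step v∼m (step m∼u here) , _) = _ , v∼m , m∼u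

  path⇒layer₂ : ∀ {v m u} → v ≢ u → ¬ v ∼[ G ] u →
                v ∼[ G ] m → m ∼[ G ] u → Layer G v 2 u
  path⇒layer₂ v≢u v≁u v∼m m∼u = step v∼m (step m∼u here) , λ where
    here            → v≢u refl
    (step v∼u here) → v≁u v∼u

layer₂-transfer : (H H' : Graph n) {v b : Fin n} →
  (∀ u → adj H' v u ≡ adj H v u) →
  (∀ m u → ¬ v ∼[ H ] u → u ≢ b → adj H' m u ≡ adj H m u) →
  Layer H' v 2 b → ∀ u → Layer H v 2 u → Layer H' v 2 u
layer₂-transfer H H' {b = b} N-kept far-kept Lb u Lu with u ≟ b
... | yes refl = Lb
... | no u≢b   with layer₂⇒path H Lu
...   | m , v∼m , m∼u =
  path⇒layer₂ H' (layer₂⇒≢ H Lu)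
    (λ v∼u → layer₂⇒≁ H Lu (trans (≡.sym (N-kept u)) v∼u))
    (trans (N-kept m) v∼m)
    (trans (far-kept m u (layer₂⇒≁ H Lu) u≢b) m∼u)

module _ (G : Graph n) {v x a b : Fin n} where

  deg-dominating-neighbour : v ∼[ G ] x → Layer G v 2 a → Layer G v 2 b →
    a ≢ b → x ∼[ G ] a → x ∼[ G ] b →
    (∀ w → v ∼[ G ] w → w ≢ x → x ∼[ G ] w) →
    deg G v + 2 ≤ deg G x
  deg-dominating-neighbour v∼x La Lb a≢b x∼a x∼b dominated =
    +-cancelʳ-≤ 1 (deg G v + 2) (deg G x)
      (subst₂ _≤_ (trans sum-f (≡.sym (+-assoc (deg G v) 2 1))) sum-g
        (sum-map-mono-≤ f≤g (allFin n)))
    where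
    χ : Bool → ℕ
    χ t = if t then 1 else 0

    -- f and g count N(v) ⊎ {v, a, b} and N(x) ⊎ {x}; the former lies in the latter.
    f g : Fin n → ℕ
    f w = χ (adj G v w) + (indicator v w + (indicator a w + indicator b w))
    g w = χ (adj G x w) + indicator x w

    g-pos : ∀ {w} k → x ∼[ G ] w → 1 ≤ χ (adj G x w) + k
    g-pos k x∼w rewrite x∼w = s≤s z≤n

    f≤g : ∀ w → f w ≤ g w
    f≤g w with adj G v w in v∼w
    ... | true rewrite indicator-≢ (≢-sym (∼⇒≢ G v∼w))
                     | indicator-≢ (≢-sym (layer₂⇒≢-neighbour G La v∼w))
                     | indicator-≢ (≢-sym (layer₂⇒≢-neighbour G Lb v∼w))
                     with w ≟ x
    ...   | yes refl = m≤n+m 1 _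
    ...   | no w≢x   = g-pos 0 (dominated w v∼w w≢x)
    f≤g w | false with w ≟ v | w ≟ a | w ≟ b
    ... | no _     | no _     | no _     = z≤n
    ... | yes refl | no _     | no _     = g-pos _ (∼-sym G v∼x)
    ... | no _     | yes refl | no _     = g-pos _ x∼a
    ... | no _     | no _     | yes refl = g-pos _ x∼b
    ... | yes refl | yes refl | _        = contradiction refl (layer₂⇒≢ G La)
    ... | yes refl | _        | yes refl = contradiction refl (layer₂⇒≢ G Lb)
    ... | _        | yes refl | yes refl = contradiction refl a≢b

    sum-f : sum (map f (allFin n)) ≡ deg G v + 3
    sum-f rewrite sum-map-+ (λ w → χ (adj G v w))
                    (λ w → indicator v w + (indicator a w + indicator b w)) (allFin n)
                | sum-map-+ (indicator v) (λ w → indicator a w + indicator b w) (allFin n)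
                | sum-map-+ (indicator a) (indicator b) (allFin n)
                | sum-indicator v | sum-indicator a | sum-indicator b = refl

    sum-g : sum (map g (allFin n)) ≡ deg G x + 1
    sum-g rewrite sum-map-+ (λ w → χ (adj G x w)) (indicator x) (allFin n)
                | sum-indicator x = refl

  dominates? : ∀ w → Dec (v ∼[ G ] w → w ≢ x → x ∼[ G ] w)
  dominates? w = ∼? G v w →-dec ¬? (w ≟ x) →-dec ∼? G x w

  neighbour-not-adjacent : ∀ {d} → Regular d G → v ∼[ G ] x →
    Layer G v 2 a → Layer G v 2 b → a ≢ b → x ∼[ G ] a → x ∼[ G ] b →
    ∃[ w ] (v ∼[ G ] w × w ≢ x × ¬ x ∼[ G ] w)
  neighbour-not-adjacent {d} regular v∼x La Lb a≢b x∼a x∼b with all? dominates?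
  ... | yes dominated = contradiction
          (subst₂ (λ dv dx → dv + 2 ≤ dx) (regular v) (regular x)
            (deg-dominating-neighbour v∼x La Lb a≢b x∼a x∼b dominated))
          (m+1+n≰m d)
  ... | no ¬dominated with ¬∀⟶∃¬ n _ dominates? ¬dominated
  ...   | w , ¬dominates-w = w ,
            decidable-stable (∼? G v w ×-dec ¬? (w ≟ x) ×-dec ¬? (∼? G x w))
              λ ¬witness → ¬dominates-w λ v∼w w≢x →
                decidable-stable (∼? G x w) λ x≁w → ¬witness (v∼w , w≢x , x≁w)

module _ {p q a c : Fin n} where

  samePair? : Dec (SamePair p q a c)
  samePair? = ((p ≟ a) ×-dec (q ≟ c)) ⊎-dec ((p ≟ c) ×-dec (q ≟ a))

  samePair-swap : SamePair p q a c → SamePair q p a c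
  samePair-swap (inj₁ (p≡a , q≡c)) = inj₂ (q≡c , p≡a)
  samePair-swap (inj₂ (p≡c , q≡a)) = inj₁ (q≡a , p≡c)

  ¬SamePair-∉ˡ : p ≢ a → p ≢ c → ¬ SamePair p q a c
  ¬SamePair-∉ˡ p≢a _ (inj₁ (p≡a , _)) = p≢a p≡a
  ¬SamePair-∉ˡ _ p≢c (inj₂ (p≡c , _)) = p≢c p≡c

  ¬SamePair-∉₁ : p ≢ a → q ≢ a → ¬ SamePair p q a c
  ¬SamePair-∉₁ p≢a _ (inj₁ (p≡a , _)) = p≢a p≡a
  ¬SamePair-∉₁ _ q≢a (inj₂ (_ , q≡a)) = q≢a q≡a

  ¬SamePair-∉₂ : p ≢ c → q ≢ c → ¬ SamePair p q a c
  ¬SamePair-∉₂ _ q≢c (inj₁ (_ , q≡c)) = q≢c q≡c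
  ¬SamePair-∉₂ p≢c _ (inj₂ (p≡c , _)) = p≢c p≡c

¬SamePair-loop : {p a c : Fin n} → a ≢ c → ¬ SamePair p p a c
¬SamePair-loop a≢c (inj₁ (p≡a , p≡c)) = a≢c (trans (≡.sym p≡a) p≡c)
¬SamePair-loop a≢c (inj₂ (p≡c , p≡a)) = a≢c (trans (≡.sym p≡a) p≡c)

module _ (G : Graph n) (e₁ e₂ e₃ e₄ f₁ f₂ f₃ f₄ : Fin n) where

  Swapped : Fin n → Fin n → Set
  Swapped p q = (p ∼[ G ] q × ¬ SamePair p q e₁ e₂ × ¬ SamePair p q e₃ e₄)
                ⊎ SamePair p q f₁ f₂ ⊎ SamePair p q f₃ f₄

  swapped? : ∀ p q → Dec (Swapped p q)
  swapped? p q = (∼? G p q ×-dec ¬? samePair? ×-dec ¬? samePair?)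
                 ⊎-dec samePair? ⊎-dec samePair?

  swapped-sym : ∀ {p q} → Swapped p q → Swapped q p
  swapped-sym (inj₁ (p∼q , ¬e₁₂ , ¬e₃₄)) =
    inj₁ (∼-sym G p∼q , (λ s → ¬e₁₂ (samePair-swap s)) , λ s → ¬e₃₄ (samePair-swap s))
  swapped-sym (inj₂ (inj₁ f₁₂)) = inj₂ (inj₁ (samePair-swap f₁₂))
  swapped-sym (inj₂ (inj₂ f₃₄)) = inj₂ (inj₂ (samePair-swap f₃₄))

  swap : f₁ ≢ f₂ → f₃ ≢ f₄ → Graph n
  swap f₁≢f₂ f₃≢f₄ = record
    { adj    = λ p q → does (swapped? p q)
    ; sym    = λ p q → does-⇔ (mk⇔ swapped-sym swapped-sym) (swapped? p q) (swapped? q p)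
    ; irrefl = λ p → dec-false (swapped? p p) λ where
        (inj₁ (p∼p , _))  → ∼⇒≢ G p∼p refl
        (inj₂ (inj₁ f₁₂)) → ¬SamePair-loop f₁≢f₂ f₁₂
        (inj₂ (inj₂ f₃₄)) → ¬SamePair-loop f₃≢f₄ f₃₄
    }

  module _ (f₁≢f₂ : f₁ ≢ f₂) (f₃≢f₄ : f₃ ≢ f₄) where

    swap-Swap : Swap G (swap f₁≢f₂ f₃≢f₄) e₁ e₂ e₃ e₄ f₁ f₂ f₃ f₄
    swap-Swap p q = mk⇔ (does-true⇒ (swapped? p q)) (dec-true (swapped? p q))

    swap-unchanged : ∀ {p q} → ¬ SamePair p q e₁ e₂ → ¬ SamePair p q e₃ e₄ →
      ¬ SamePair p q f₁ f₂ → ¬ SamePair p q f₃ f₄ →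
      adj (swap f₁≢f₂ f₃≢f₄) p q ≡ adj G p q
    swap-unchanged {p} {q} ¬e₁₂ ¬e₃₄ ¬f₁₂ ¬f₃₄ = keeps (adj G p q) refl
      where
      keeps : ∀ t → adj G p q ≡ t → does (swapped? p q) ≡ t
      keeps true  p∼q = dec-true (swapped? p q) (inj₁ (p∼q , ¬e₁₂ , ¬e₃₄))
      keeps false p≁q = dec-false (swapped? p q) λ where
        (inj₁ (p∼q , _))  → contradiction (trans (≡.sym p≁q) p∼q) λ ()
        (inj₂ (inj₁ f₁₂)) → ¬f₁₂ f₁₂
        (inj₂ (inj₂ f₃₄)) → ¬f₃₄ f₃₄

module Δ⁺ (G : Graph n) {x y w z : Fin n} (x≢w : x ≢ w) (y≢z : y ≢ z) where

  graph : Graph n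
  graph = swap G x y w z x w y z x≢w y≢z

  Δ⁺-Swap : Swap G graph x y w z x w y z
  Δ⁺-Swap = swap-Swap G x y w z x w y z x≢w y≢z

  unchanged-at : ∀ {p} → p ≢ x → p ≢ y → p ≢ w → p ≢ z →
                 ∀ q → adj graph p q ≡ adj G p q
  unchanged-at p≢x p≢y p≢w p≢z q = swap-unchanged G x y w z x w y z x≢w y≢z
    (¬SamePair-∉ˡ p≢x p≢y) (¬SamePair-∉ˡ p≢w p≢z)
    (¬SamePair-∉ˡ p≢x p≢w) (¬SamePair-∉ˡ p≢y p≢z)

  -- Each of the four changed pairs contains x, w or z.
  unchanged-away : ∀ {p q} → p ≢ x → p ≢ w → p ≢ z → q ≢ x → q ≢ z →
                   adj graph p q ≡ adj G p q
  unchanged-away p≢x p≢w p≢z q≢x q≢z = swap-unchanged G x y w z x w y z x≢w y≢z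
    (¬SamePair-∉₁ p≢x q≢x) (¬SamePair-∉ˡ p≢w p≢z)
    (¬SamePair-∉ˡ p≢x p≢w) (¬SamePair-∉₂ p≢z q≢z)

module Reattach (G : Graph n) {v x a b w y : Fin n}
  (v∼x : v ∼[ G ] x) (v∼w : v ∼[ G ] w) (v∼y : v ∼[ G ] y) (w∼y : w ∼[ G ] y)
  (w≢x : w ≢ x) (x≁w : ¬ x ∼[ G ] w)
  (La : Layer G v 2 a) (Lb : Layer G v 2 b) (a≢b : a ≢ b) (a∼x : a ∼[ G ] x)
  (b∼x : b ∼[ G ] x) (x-only : ∀ c → v ∼[ G ] c → b ∼[ G ] c → c ≡ x) where

  y≢x : y ≢ x
  y≢x refl = x≁w (∼-sym G w∼y)

  private
    ≁⇒≢ : ∀ {u c} → ¬ v ∼[ G ] u → v ∼[ G ] c → u ≢ c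
    ≁⇒≢ v≁u v∼c refl = v≁u v∼c

    b≢y : b ≢ y
    b≢y = layer₂⇒≢-neighbour G Lb v∼y

    b≁y : ¬ b ∼[ G ] y
    b≁y b∼y = y≢x (x-only y v∼y b∼y)

  open Δ⁺ G (≢-sym w≢x) b≢y public using (graph)
  open Δ⁺ G (≢-sym w≢x) b≢y using (Δ⁺-Swap; unchanged-at; unchanged-away)

  switch : Δ⁺Switch G v graph
  switch = x , b , w , y
    , ( ∼⇒≢ G v∼x , layer₂⇒≢ G Lb , ∼⇒≢ G v∼w , ∼⇒≢ G v∼y
      , ≢-sym (layer₂⇒≢-neighbour G Lb v∼x) , ≢-sym w≢x , ≢-sym y≢x
      , layer₂⇒≢-neighbour G Lb v∼w , b≢y , ∼⇒≢ G w∼y )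
    , b∼x , ∼-sym G v∼x , v∼w , w∼y , x≁w , b≁y , Δ⁺-Swap

  N-kept : ∀ u → adj graph v u ≡ adj G v u
  N-kept = unchanged-at (∼⇒≢ G v∼x) (layer₂⇒≢ G Lb) (∼⇒≢ G v∼w) (∼⇒≢ G v∼y)

  far-kept : ∀ m u → ¬ v ∼[ G ] u → u ≢ b → adj graph m u ≡ adj G m u
  far-kept m u v≁u u≢b = begin
    adj graph m u ≡⟨ sym graph m u ⟩
    adj graph u m ≡⟨ unchanged-at (≁⇒≢ v≁u v∼x) u≢b (≁⇒≢ v≁u v∼w) (≁⇒≢ v≁u v∼y) m ⟩
    adj G u m     ≡⟨ sym G u m ⟩
    adj G m u     ∎
    where open ≡-Reasoning

  b∼y′ : b ∼[ graph ] y
  b∼y′ = from (Δ⁺-Swap b y) (inj₂ (inj₂ (inj₁ (refl , refl))))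

  a∼x′ : a ∼[ graph ] x
  a∼x′ = trans (unchanged-at (layer₂⇒≢-neighbour G La v∼x) a≢b
                 (layer₂⇒≢-neighbour G La v∼w) (layer₂⇒≢-neighbour G La v∼y) x) a∼x

  N-v-kept : ∀ u → (v ∼[ graph ] u) ⇔ (v ∼[ G ] u)
  N-v-kept u = mk⇔ (trans (≡.sym (N-kept u))) (trans (N-kept u))

  V₂-kept : ∀ u → Layer graph v 2 u ⇔ Layer G v 2 u
  V₂-kept u = mk⇔ (layer₂-transfer graph G (λ u → ≡.sym (N-kept u)) far-kept⁻¹ Lb u)
                  (layer₂-transfer G graph N-kept far-kept Lb′ u)
    where
    Lb′ : Layer graph v 2 b
    Lb′ = path⇒layer₂ graph (layer₂⇒≢ G Lb)
      (λ v∼b → layer₂⇒≁ G Lb (trans (≡.sym (N-kept b)) v∼b))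
      (trans (N-kept y) v∼y) (∼-sym graph b∼y′)
    far-kept⁻¹ : ∀ m u → ¬ v ∼[ graph ] u → u ≢ b → adj G m u ≡ adj graph m u
    far-kept⁻¹ m u v≁u u≢b =
      ≡.sym (far-kept m u (λ v∼u → v≁u (trans (N-kept u) v∼u)) u≢b)

  E₂-kept : ∀ p q → Layer G v 2 p → Layer G v 2 q → adj graph p q ≡ adj G p q
  E₂-kept p q Lp Lq = unchanged-away
    (layer₂⇒≢-neighbour G Lp v∼x) (layer₂⇒≢-neighbour G Lp v∼w) (layer₂⇒≢-neighbour G Lp v∼y)
    (layer₂⇒≢-neighbour G Lq v∼x) (layer₂⇒≢-neighbour G Lq v∼y)

lemma3p4 : ∀ {n} (d : ℕ) → d ≥ 3 → (G : Graph n) → Regular d G → (v : Fin n)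
    → (∀ u → Layer G v 1 u → ∃[ w ] (Layer G v 1 w × u ∼[ G ] w))
    → (a b x : Fin n) → Layer G v 2 a → Layer G v 2 b → a ≢ b → ¬ (a ∼[ G ] b)
    → Layer G v 1 x
    → (∀ w → (Layer G v 1 w × a ∼[ G ] w) ⇔ (w ≡ x))
    → (∀ w → (Layer G v 1 w × b ∼[ G ] w) ⇔ (w ≡ x))
    → ∃[ G' ] (ΔSwitch G v G'
        × (∀ u → (v ∼[ G' ] u) ⇔ (v ∼[ G ] u))
        × (∀ u → Layer G' v 2 u ⇔ Layer G v 2 u)
        × (∀ p q → Layer G v 2 p → Layer G v 2 q → adj G' p q ≡ adj G p q)
        × a ∼[ G' ] x
        × ∃[ y ] (v ∼[ G ] y × y ≢ x × b ∼[ G' ] y))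
lemma3p4 d _ G regular v V₁-no-isolated a b x La Lb a≢b _ Lx In-a In-b =
  let v∼x = layer₁⇒∼ G Lx
      a∼x = proj₂ (from (In-a x) refl)
      b∼x = proj₂ (from (In-b x) refl)
      (w , v∼w , w≢x , x≁w) =
        neighbour-not-adjacent G regular v∼x La Lb a≢b (∼-sym G a∼x) (∼-sym G b∼x)
      (y , Ly , w∼y) = V₁-no-isolated w (∼⇒layer₁ G v∼w)
      open Reattach G v∼x v∼w (layer₁⇒∼ G Ly) w∼y w≢x x≁w La Lb a≢b a∼x b∼x
             (λ c v∼c b∼c → to (In-b c) (∼⇒layer₁ G v∼c , b∼c))
  in graph , inj₁ switch , N-v-kept , V₂-kept , E₂-kept , a∼x′
   , y , layer₁⇒∼ G Ly , y≢x , b∼y′
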